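{- Let $t$ be a positive integer, let $D=(V,A)$ be a $P_{t+1,2}$-free digraph, and let $S\subset V$ and $u\in V\setminus S$. Then $e(W,S)\le t|S|$ for all $W\subseteq N^+(u)$.
   Context: All digraphs are strict: no loops and no parallel arcs (opposite arcs $uv,vu$ allowed). $P_{t+1,2}$ denotes the digraph consisting of $t+1$ directed paths of length 2 with the same initial vertex and the same terminal vertex (vertices $x,y,z_1,\dots,z_{t+1}$ all distinct, arcs $xz_i$, $z_iy$); $D$ is $P_{t+1,2}$-free if it has no subdigraph isomorphic to it. $N^+(u)=\{x\in V: ux\in A\}$ is the set of successors of $u$, and for $W,S\subseteq V$, $e(W,S)$ is the number of arcs from a vertex of $W$ to a vertex of $S$. -}

module Defs where

open import Data.Nat using (ℕ; suc; _+_)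
open import Data.Bool using (Bool; true; false; _∧_)
open import Data.Fin using (Fin)
open import Data.Fin.Subset using (Subset; _∈_; _⊆_; ∣_∣)
open import Data.Vec using (tabulate; lookup)
open import Data.List using (List; map; allFin)
open import Data.Nat.ListAction using (sum)
open import Data.Product using (_×_; Σ; ∃-syntax)
open import Relation.Binary.PropositionalEquality using (_≡_; _≢_)
open import Relation.Nullary using (¬_)
open import Function.Definitions using (Injective)

-- Parallel arcs are impossible by construction; opposite arcs are allowed.
record Digraph (n : ℕ) : Set where
  field
    arc   : Fin n → Fin n → Bool
    loopless : ∀ v → arc v v ≡ false
open Digraph public

N⁺ : ∀ {n} → Digraph n → Fin n → Subset n
N⁺ D u = tabulate (λ x → arc D u x)

mem : ∀ {n} → Subset n → Fin n → Bool
mem S v = lookup S v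

count : List Bool → ℕ
count bs = sum (map (λ { true → 1 ; false → 0 }) bs)

e : ∀ {n} → Digraph n → Subset n → Subset n → ℕ
e {n} D W S =
  sum (map (λ w → count (map (λ s → mem W w ∧ (mem S s ∧ arc D w s)) (allFin n)))
           (allFin n))

-- D contains a subdigraph isomorphic to P_{k,2}: distinct x, y and k
-- distinct vertices z_1..z_k (all different from x and y) with arcs
-- x z_i and z_i y.
ContainsP2 : ∀ {n} → ℕ → Digraph n → Set
ContainsP2 {n} k D =
  ∃[ x ] ∃[ y ] Σ (Fin k → Fin n) λ z →
    (x ≢ y) × Injective _≡_ _≡_ z ×
    (∀ i → z i ≢ x) × (∀ i → z i ≢ y) ×
    (∀ i → arc D x (z i) ≡ true) × (∀ i → arc D (z i) y ≡ true)

P2Free : ∀ {n} → ℕ → Digraph n → Set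
P2Free k D = ¬ ContainsP2 k D

{-# OPTIONS --safe #-}
module Submission where

-- Count e(W,S) one arc head s ∈ S at a time. Every w ∈ W with ws ∈ A is a
-- successor of u and a predecessor of s, and u ≠ s since u ∉ S; so t+1 such
-- w, with x = u and y = s, would form a P_{t+1,2}. Hence each s ∈ S receives
-- at most t arcs from W.

open import Defs
open import Data.Bool using (Bool; true; false; _∧_)
open import Data.Bool.Properties using (∧-zeroʳ)
open import Data.Empty using (⊥-elim)
open import Data.Fin using (Fin; zero; suc)
open import Data.Fin.Properties using (suc-injective)
open import Data.Fin.Subset using (Subset; _∉_; _⊆_; ∣_∣)
open import Data.List using (List; []; _∷_; map; allFin; tabulate)
open import Data.List.Properties using (map-tabulate)
import Data.Nat.ListAction as List
open import Data.Nat using (ℕ; zero; suc; _+_; _*_; _≤_; s≤s; z≤n)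
open import Data.Nat.Properties
  using (+-*-semiring; +-mono-≤; ≤-refl; ≤-reflexive; ≮⇒≥; _<?_; *-zeroʳ; *-identityʳ; module ≤-Reasoning)
open import Algebra.Properties.Semiring.Sum +-*-semiring
  using (sum; sum-syntax; ∑-comm; sum-cong-≗; sum-replicate-zero; *-distribˡ-sum)
open import Data.Product using (Σ-syntax; _×_; _,_; proj₁; proj₂)
import Data.Vec as Vec
open import Data.Vec.Properties using ([]=⇒lookup; lookup⇒[]=; lookup∘tabulate)
open import Function using (_∘_; id)
open import Function.Definitions using (Injective)
open import Relation.Binary.PropositionalEquality
open import Relation.Nullary using (yes; no)

𝟙 : Bool → ℕ
𝟙 true  = 1
𝟙 false = 0

#_ : ∀ {n} → (Fin n → Bool) → ℕ
#_ {n} p = ∑[ i < n ] 𝟙 (p i)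

∧≡true⇒× : ∀ {a b} → a ∧ b ≡ true → a ≡ true × b ≡ true
∧≡true⇒× {true} {true} _ = refl , refl

∧-monoˡ-true : ∀ {a b c} → (a ≡ true → b ≡ true) → a ∧ c ≡ true → b ∧ c ≡ true
∧-monoˡ-true a⇒b ac with ∧≡true⇒× ac
... | a , c = cong₂ _∧_ (a⇒b a) c

𝟙-mono : ∀ {a b} → (a ≡ true → b ≡ true) → 𝟙 a ≤ 𝟙 b
𝟙-mono {false}         _   = z≤n
𝟙-mono {true}  {true}  _   = ≤-refl
𝟙-mono {true}  {false} a⇒b with a⇒b refl
... | ()

sum-mono-≤ : ∀ {n} {f g : Fin n → ℕ} → (∀ i → f i ≤ g i) → sum f ≤ sum g
sum-mono-≤ {zero}  f≤g = z≤n
sum-mono-≤ {suc n} f≤g = +-mono-≤ (f≤g zero) (sum-mono-≤ (f≤g ∘ suc))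

#-mono : ∀ {n} {p q : Fin n → Bool} → (∀ i → p i ≡ true → q i ≡ true) → # p ≤ # q
#-mono p⇒q = sum-mono-≤ (λ i → 𝟙-mono (p⇒q i))

#-none : ∀ {n} {p : Fin n → Bool} → (∀ i → p i ≡ false) → # p ≡ 0
#-none {n} p≡false = trans (sum-cong-≗ (cong 𝟙 ∘ p≡false)) (sum-replicate-zero n)

≤#⇒injection : ∀ {n} (p : Fin n → Bool) {k} → k ≤ # p →
  Σ[ z ∈ (Fin k → Fin n) ] Injective _≡_ _≡_ z × (∀ i → p (z i) ≡ true)
≤#⇒injection p {zero} _ = (λ ()) , (λ { {()} }) , (λ ())
≤#⇒injection {suc n} p {suc k} k<#p with p zero in p₀
... | false with ≤#⇒injection (p ∘ suc) k<#p
...   | z , z-inj , pz = suc ∘ z , z-inj ∘ suc-injective , pz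
≤#⇒injection {suc n} p {suc k} (s≤s k≤#p) | true with ≤#⇒injection (p ∘ suc) k≤#p
...   | z , z-inj , pz = z′ , z′-inj , pz′
  where
  z′ : Fin (suc k) → Fin (suc n)
  z′ zero    = zero
  z′ (suc i) = suc (z i)
  z′-inj : Injective _≡_ _≡_ z′
  z′-inj {zero}  {zero}  _  = refl
  z′-inj {zero}  {suc _} ()
  z′-inj {suc _} {zero}  ()
  z′-inj {suc i} {suc j} eq = cong suc (z-inj (suc-injective eq))
  pz′ : ∀ i → p (z′ i) ≡ true
  pz′ zero    = p₀
  pz′ (suc i) = pz i

sum-tabulate : ∀ n (f : Fin n → ℕ) → List.sum (tabulate f) ≡ ∑[ i < n ] f i
sum-tabulate zero    f = refl
sum-tabulate (suc n) f = cong (f zero +_) (sum-tabulate n (f ∘ suc))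

count-map : ∀ {A : Set} (p : A → Bool) (xs : List A) →
  count (map p xs) ≡ List.sum (map (𝟙 ∘ p) xs)
count-map p []       = refl
count-map p (x ∷ xs) with p x
... | true  = cong suc (count-map p xs)
... | false = count-map p xs

sum-map-allFin : ∀ n (f : Fin n → ℕ) → List.sum (map f (allFin n)) ≡ ∑[ i < n ] f i
sum-map-allFin n f = trans (cong List.sum (map-tabulate id f)) (sum-tabulate n f)

count-map-allFin : ∀ n (p : Fin n → Bool) → count (map p (allFin n)) ≡ # p
count-map-allFin n p = trans (count-map p (allFin n)) (sum-map-allFin n (𝟙 ∘ p))

∣S∣≡#mem : ∀ {n} (S : Subset n) → ∣ S ∣ ≡ # mem S
∣S∣≡#mem Vec.[]          = refl
∣S∣≡#mem (true  Vec.∷ S) = cong suc (∣S∣≡#mem S)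
∣S∣≡#mem (false Vec.∷ S) = ∣S∣≡#mem S

e≡∑#in-arcs : ∀ {n} (D : Digraph n) (W S : Subset n) →
  e D W S ≡ ∑[ s < n ] # (λ w → mem W w ∧ (mem S s ∧ arc D w s))
e≡∑#in-arcs {n} D W S = begin
  e D W S                                   ≡⟨ sum-map-allFin n _ ⟩
  ∑[ w < n ] count (map (arcs w) (allFin n)) ≡⟨ sum-cong-≗ (λ w → count-map-allFin n (arcs w)) ⟩
  ∑[ w < n ] # arcs w                       ≡⟨ ∑-comm (λ w s → 𝟙 (arcs w s)) ⟩
  ∑[ s < n ] # (λ w → arcs w s)             ∎
  where
  open ≡-Reasoning
  arcs : Fin n → Fin n → Bool
  arcs w s = mem W w ∧ (mem S s ∧ arc D w s)

mem-N⁺ : ∀ {n} (D : Digraph n) u v → mem (N⁺ D u) v ≡ arc D u v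
mem-N⁺ D u = lookup∘tabulate (arc D u)

mem-⊆ : ∀ {n} {V W : Subset n} {v} → V ⊆ W → mem V v ≡ true → mem W v ≡ true
mem-⊆ {V = V} {v = v} V⊆W v∈V = []=⇒lookup (V⊆W (lookup⇒[]= v V v∈V))

arc⇒≢ : ∀ {n} (D : Digraph n) {x y} → arc D x y ≡ true → x ≢ y
arc⇒≢ D {x} xy refl with trans (sym xy) (loopless D x)
... | ()

#common-out-in-neighbours≤ : ∀ {n t} (D : Digraph n) → P2Free (suc t) D →
  ∀ {x y} → x ≢ y → # (λ z → arc D x z ∧ arc D z y) ≤ t
#common-out-in-neighbours≤ {t = t} D free {x} {y} x≢y with t <? # (λ z → arc D x z ∧ arc D z y)
... | no  t≮# = ≮⇒≥ t≮#
... | yes t<# with ≤#⇒injection _ t<#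
...   | z , z-inj , xzy =
  ⊥-elim (free (x , y , z , x≢y , z-inj , z≢x , z≢y , xz , zy))
  where
  xz : ∀ i → arc D x (z i) ≡ true
  xz = proj₁ ∘ ∧≡true⇒× ∘ xzy
  zy : ∀ i → arc D (z i) y ≡ true
  zy = proj₂ ∘ ∧≡true⇒× ∘ xzy
  z≢x : ∀ i → z i ≢ x
  z≢x i = ≢-sym (arc⇒≢ D (xz i))
  z≢y : ∀ i → z i ≢ y
  z≢y i = arc⇒≢ D (zy i)

lemma2p2 : (t : ℕ) → 1 ≤ t → (n : ℕ) → (D : Digraph n) → P2Free (suc t) D →
    (S : Subset n) → (u : Fin n) → u ∉ S →
    (W : Subset n) → W ⊆ N⁺ D u → e D W S ≤ t * ∣ S ∣
lemma2p2 t _ n D free S u u∉S W W⊆N⁺u = begin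
  e D W S                                               ≡⟨ e≡∑#in-arcs D W S ⟩
  ∑[ s < n ] # (λ w → mem W w ∧ (mem S s ∧ arc D w s)) ≤⟨ sum-mono-≤ in-arcs≤ ⟩
  ∑[ s < n ] (t * 𝟙 (mem S s))                          ≡⟨ *-distribˡ-sum t (𝟙 ∘ mem S) ⟨
  t * # mem S                                           ≡⟨ cong (t *_) (∣S∣≡#mem S) ⟨
  t * ∣ S ∣                                             ∎
  where
  open ≤-Reasoning
  in-arcs≤ : ∀ s → # (λ w → mem W w ∧ (mem S s ∧ arc D w s)) ≤ t * 𝟙 (mem S s)
  in-arcs≤ s with mem S s in s∈S
  ... | false = ≤-reflexive (trans (#-none (λ w → ∧-zeroʳ (mem W w))) (sym (*-zeroʳ t)))
  ... | true  = begin
    # (λ w → mem W w ∧ arc D w s)   ≤⟨ #-mono (λ w → ∧-monoˡ-true (W⇒arc w)) ⟩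
    # (λ w → arc D u w ∧ arc D w s) ≤⟨ #common-out-in-neighbours≤ D free u≢s ⟩
    t                               ≡⟨ *-identityʳ t ⟨
    t * 1                           ∎
    where
    W⇒arc : ∀ w → mem W w ≡ true → arc D u w ≡ true
    W⇒arc w w∈W = trans (sym (mem-N⁺ D u w)) (mem-⊆ W⊆N⁺u w∈W)
    u≢s : u ≢ s
    u≢s refl = u∉S (lookup⇒[]= u S s∈S)
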